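{- Let $k\geq 2$, $\mu>0$, and let $G$ be a $\mu$-balanced $k$-partite linear $k$-uniform hypergraph on $n$ vertices with vertex classes $X_1,\dots,X_k$ such that $|X_1|\leq\dots \leq |X_k|$. Let $t$ be a positive integer with $t\leq \frac{|X_1|}{2k\mu}+1$. Then $G$ contains at least $\left(\frac{e(G)}{2t}\right)^t$ matchings of size $t$.
   Context: A hypergraph is linear if any two distinct edges intersect in at most one vertex. A $k$-partite $k$-uniform hypergraph $G$ with parts $X_1,\dots,X_k$ (each edge has exactly one vertex in each part) is $\mu$-balanced if for each $i$, $\max_{w\in X_i} d_G(w)\leq \mu e(G)/|X_i|$. A matching of size $t$ is a set of $t$ pairwise disjoint edges.
   Formalization: The balance parameter μ ranges over the positive rationals. -}

module Defs where

open import Data.Nat as ℕ using (ℕ; zero; suc; _+_; _*_; _∸_; _^_)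
open import Data.Fin as Fin using (Fin)
open import Data.Fin.Properties using (all?; _≟_)
open import Data.List using (List; []; _∷_; [_]; map; _++_; filter; length)
open import Data.List.Relation.Unary.AllPairs using (AllPairs; allPairs?)
open import Data.Integer using (+_)
open import Data.Rational as ℚ using (ℚ; _/_)
open import Relation.Binary.PropositionalEquality using (_≡_; _≢_)
open import Relation.Nullary using (¬_; Dec; yes; no; ¬?)


ℕ→ℚ : ℕ → ℚ
ℕ→ℚ n = + n / 1

-- A k-partite k-uniform hypergraph with parts X_i = Fin (s i):
-- an edge picks exactly one vertex in each part.
Edge : (k : ℕ) → (Fin k → ℕ) → Set
Edge k s = (i : Fin k) → Fin (s i)

SameEdge : ∀ {k s} → Edge k s → Edge k s → Set
SameEdge e f = ∀ i → e i ≡ f i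

record Hypergraph (k : ℕ) (s : Fin k → ℕ) : Set where
  field
    edges    : List (Edge k s)
    distinct : AllPairs (λ e f → ¬ SameEdge e f) edges
open Hypergraph public

e : ∀ {k s} → Hypergraph k s → ℕ
e G = length (edges G)

deg : ∀ {k s} → Hypergraph k s → (i : Fin k) → Fin (s i) → ℕ
deg G i w = length (filter (λ f → f i ≟ w) (edges G))

-- linear: two distinct edges share at most one vertex
-- (the vertex (i , v) lies in edge f iff f i ≡ v)
Linear : ∀ {k s} → Hypergraph k s → Set
Linear G = AllPairs (λ f g → ∀ i j → f i ≡ g i → f j ≡ g j → i ≡ j) (edges G)

-- μ-balanced: for all i and w ∈ X_i, d(w) ≤ μ e(G) / |X_i|
-- (stated multiplied out by |X_i| > 0; X_i nonempty whenever w exists)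
Balanced : ∀ {k s} → ℚ → Hypergraph k s → Set
Balanced {k} {s} μ G = ∀ (i : Fin k) (w : Fin (s i)) →
  ℕ→ℚ (deg G i w) ℚ.* ℕ→ℚ (s i) ℚ.≤ μ ℚ.* ℕ→ℚ (e G)

Disjoint : ∀ {k s} → Edge k s → Edge k s → Set
Disjoint f g = ∀ i → f i ≢ g i

disjoint? : ∀ {k s} (f g : Edge k s) → Dec (Disjoint f g)
disjoint? f g = all? (λ i → ¬? (f i ≟ g i))

combinations : ∀ {A : Set} → ℕ → List A → List (List A)
combinations zero    xs       = [ [] ]
combinations (suc t) []       = []
combinations (suc t) (x ∷ xs) = map (x ∷_) (combinations t xs) ++ combinations (suc t) xs

numMatchings : ∀ {k s} → Hypergraph k s → ℕ → ℕ
numMatchings G t = length (filter (allPairs? disjoint?) (combinations t (edges G)))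

-- Call two edges compatible when they are disjoint. An edge meets at most k·Δ edges, Δ the
-- maximum degree, and balancedness together with the bound on t gives 2(t − 1)·kΔ ≤ e(G).
-- Choosing the edges of a matching one at a time, every choice therefore still leaves at least
-- e(G)/2 edges compatible with all earlier ones, so there are at least (e(G)/2)^t ordered
-- matchings of size t; each matching is counted t! ≤ t^t times.
module Submission where

open import Defs
open import Data.Nat using (ℕ; suc; _≤_; _*_; _^_; _∸_; s≤s; z≤n)
open import Data.Nat.Properties using (≤-trans)
open import Data.Fin as Fin using (Fin; fromℕ<)
open import Data.Rational as ℚ using (ℚ)

open import Data.Nat using (zero; _+_; _!)
open import Data.Nat.Properties
  using (≤-refl; ≤-reflexive; +-assoc; +-comm; +-suc; *-comm; *-assoc; *-zeroʳ; *-identityˡ; *-distribˡ-+;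
         +-mono-≤; +-monoʳ-≤; *-mono-≤; *-monoʳ-≤; *-monoˡ-≤; ∸-monoˡ-≤; ^-monoˡ-≤; +-cancelˡ-≤;
         n≤1+n; m≤m+n; m≤n+m∸n; m≤n+o⇒m∸n≤o; +-commutativeSemigroup; *-commutativeSemigroup;
         module ≤-Reasoning)
open import Algebra.Properties.CommutativeSemigroup +-commutativeSemigroup
  using () renaming (interchange to +-interchange)
open import Algebra.Properties.CommutativeSemigroup *-commutativeSemigroup
  using () renaming (interchange to *-interchange)
open import Data.Nat.DivMod using (_/_; m/n*n≤m; m*n/n≡m; /-monoˡ-≤)
open import Data.Nat.Tactic.RingSolver using (solve-∀)
import Data.Nat.Coprimality as Coprimality
import Data.Integer as ℤ
import Data.Integer.Properties as ℤ
import Data.Rational.Properties as ℚ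
open import Data.Fin.Properties using (_≟_; any?; ¬∀⟶∃¬)
open import Data.List using (List; []; _∷_; map; _++_; filter; length)
open import Data.List.Properties
  using (filter-++; length-++; length-map; length-filter; filter-≐; filter-reject; filter-none)
open import Data.List.Relation.Unary.All as All using (_∷_)
open import Data.List.Relation.Unary.All.Properties using (map⁺)
open import Data.List.Relation.Unary.AllPairs using (_∷_; allPairs?)
open import Data.Product using (∃; ∃-syntax; _×_; _,_; swap)
open import Data.Sum using (_⊎_; inj₁; inj₂)
open import Function using (_∘_)
open import Level using (Level)
open import Relation.Binary using (Rel; Decidable; Symmetric)
open import Relation.Binary.PropositionalEquality
  using (_≡_; refl; sym; trans; cong; cong₂; subst; subst₂; module ≡-Reasoning)
open import Relation.Nullary using (¬_; yes; no; ¬?; contradiction)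
open import Relation.Nullary.Decidable using (decidable-stable)
open import Relation.Unary as U using (Pred)
open import Relation.Unary.Properties using (_∩?_; _∪?_; ∁?)

private
  variable
    a p q : Level
    A B : Set a
    P : Pred A p
    Q : Pred A q
    m n : ℕ

filter-∩ : (P? : U.Decidable P) (Q? : U.Decidable Q) → ∀ xs → filter (P? ∩? Q?) xs ≡ filter P? (filter Q? xs)
filter-∩ P? Q? [] = refl
filter-∩ P? Q? (x ∷ xs) with Q? x
... | no  _ with P? x
...   | yes _ = filter-∩ P? Q? xs
...   | no  _ = filter-∩ P? Q? xs
filter-∩ P? Q? (x ∷ xs) | yes _ with P? x
...   | yes _ = cong (x ∷_) (filter-∩ P? Q? xs)
...   | no  _ = filter-∩ P? Q? xs

filter-comm : (P? : U.Decidable P) (Q? : U.Decidable Q) → ∀ xs → filter P? (filter Q? xs) ≡ filter Q? (filter P? xs)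
filter-comm P? Q? xs = begin
  filter P? (filter Q? xs) ≡⟨ filter-∩ P? Q? xs ⟨
  filter (P? ∩? Q?) xs     ≡⟨ filter-≐ (P? ∩? Q?) (Q? ∩? P?) (swap , swap) xs ⟩
  filter (Q? ∩? P?) xs     ≡⟨ filter-∩ Q? P? xs ⟩
  filter Q? (filter P? xs) ∎
  where open ≡-Reasoning

filter-map : (P? : U.Decidable P) (f : B → A) → ∀ xs → filter P? (map f xs) ≡ map f (filter (P? ∘ f) xs)
filter-map P? f [] = refl
filter-map P? f (x ∷ xs) with P? (f x)
... | yes _ = cong (f x ∷_) (filter-map P? f xs)
... | no  _ = filter-map P? f xs

length-filter-filter : (P? : U.Decidable P) (Q? : U.Decidable Q) → ∀ xs →
  length (filter P? (filter Q? xs)) ≤ length (filter P? xs)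
length-filter-filter P? Q? xs rewrite filter-comm P? Q? xs = length-filter Q? (filter P? xs)

length-filter+length-filter-∁ : (P? : U.Decidable P) → ∀ xs → length (filter P? xs) + length (filter (∁? P?) xs) ≡ length xs
length-filter+length-filter-∁ P? [] = refl
length-filter+length-filter-∁ P? (x ∷ xs) with P? x
... | yes _ = cong suc (length-filter+length-filter-∁ P? xs)
... | no  _ = trans (+-suc _ _) (cong suc (length-filter+length-filter-∁ P? xs))

length-filter-∪ : (P? : U.Decidable P) (Q? : U.Decidable Q) → ∀ xs →
  length (filter (P? ∪? Q?) xs) ≤ length (filter P? xs) + length (filter Q? xs)
length-filter-∪ P? Q? [] = z≤n
length-filter-∪ P? Q? (x ∷ xs) with P? x | Q? x
... | yes _ | yes _ = s≤s (≤-trans (length-filter-∪ P? Q? xs) (+-monoʳ-≤ _ (n≤1+n _)))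
... | yes _ | no  _ = s≤s (length-filter-∪ P? Q? xs)
... | no  _ | yes _ = ≤-trans (s≤s (length-filter-∪ P? Q? xs)) (≤-reflexive (sym (+-suc _ _)))
... | no  _ | no  _ = length-filter-∪ P? Q? xs

length-filter-any≤ : ∀ {k} {P : Fin k → Pred A p} (P? : ∀ i → U.Decidable (P i)) {Δ} xs →
  (∀ i → length (filter (P? i) xs) ≤ Δ) → length (filter (λ x → any? (λ i → P? i x)) xs) ≤ k * Δ
length-filter-any≤ {k = zero} P? xs _ =
  ≤-reflexive (cong length (filter-none _ (All.universal (λ _ → λ { (() , _) }) xs)))
length-filter-any≤ {k = suc k} {P = P} P? {Δ} xs bound = begin
  length (filter (λ x → any? (λ i → P? i x)) xs)
    ≡⟨ cong length (filter-≐ _ _ (split , join) xs) ⟩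
  length (filter (P? Fin.zero ∪? (λ x → any? (λ i → P? (Fin.suc i) x))) xs)
    ≤⟨ length-filter-∪ (P? Fin.zero) _ xs ⟩
  length (filter (P? Fin.zero) xs) + length (filter (λ x → any? (λ i → P? (Fin.suc i) x)) xs)
    ≤⟨ +-mono-≤ (bound Fin.zero) (length-filter-any≤ (P? ∘ Fin.suc) xs (bound ∘ Fin.suc)) ⟩
  Δ + k * Δ ∎
  where
  open ≤-Reasoning
  split : ∀ {x} → ∃ (λ i → P i x) → P Fin.zero x ⊎ ∃ (λ i → P (Fin.suc i) x)
  split (Fin.zero  , p) = inj₁ p
  split (Fin.suc i , p) = inj₂ (i , p)
  join : ∀ {x} → P Fin.zero x ⊎ ∃ (λ i → P (Fin.suc i) x) → ∃ (λ i → P i x)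
  join (inj₁ p)       = Fin.zero , p
  join (inj₂ (i , p)) = Fin.suc i , p

filter-all-combinations : (P? : U.Decidable P) → ∀ t xs →
  filter (All.all? P?) (combinations t xs) ≡ combinations t (filter P? xs)
filter-all-combinations P? zero    xs       = refl
filter-all-combinations P? (suc t) []       = refl
filter-all-combinations P? (suc t) (y ∷ ys) with P? y
... | yes py = begin
  filter (All.all? P?) (map (y ∷_) (combinations t ys) ++ combinations (suc t) ys)
    ≡⟨ filter-++ (All.all? P?) (map (y ∷_) (combinations t ys)) (combinations (suc t) ys) ⟩
  filter (All.all? P?) (map (y ∷_) (combinations t ys)) ++ filter (All.all? P?) (combinations (suc t) ys)
    ≡⟨ cong₂ _++_ (filter-map (All.all? P?) (y ∷_) (combinations t ys)) (filter-all-combinations P? (suc t) ys) ⟩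
  map (y ∷_) (filter (All.all? P? ∘ (y ∷_)) (combinations t ys)) ++ combinations (suc t) (filter P? ys)
    ≡⟨ cong (λ cs → map (y ∷_) cs ++ combinations (suc t) (filter P? ys)) (begin
         filter (All.all? P? ∘ (y ∷_)) (combinations t ys)
           ≡⟨ filter-≐ (All.all? P? ∘ (y ∷_)) (All.all? P?) ((λ { (_ ∷ pcs) → pcs }) , (py ∷_)) (combinations t ys) ⟩
         filter (All.all? P?) (combinations t ys)
           ≡⟨ filter-all-combinations P? t ys ⟩
         combinations t (filter P? ys) ∎) ⟩
  combinations (suc t) (y ∷ filter P? ys) ∎
  where open ≡-Reasoning
... | no ¬py = begin
  filter (All.all? P?) (map (y ∷_) (combinations t ys) ++ combinations (suc t) ys)
    ≡⟨ filter-++ (All.all? P?) (map (y ∷_) (combinations t ys)) (combinations (suc t) ys) ⟩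
  filter (All.all? P?) (map (y ∷_) (combinations t ys)) ++ filter (All.all? P?) (combinations (suc t) ys)
    ≡⟨ cong₂ _++_ (filter-none (All.all? P?) (map⁺ (All.universal (λ { _ (py ∷ _) → ¬py py }) (combinations t ys))))
                  (filter-all-combinations P? (suc t) ys) ⟩
  combinations (suc t) (filter P? ys) ∎
  where open ≡-Reasoning

sumOver : (A → ℕ) → List A → ℕ
sumOver f []       = 0
sumOver f (x ∷ xs) = f x + sumOver f xs

syntax sumOver (λ x → e) xs = ∑[ x ∈ xs ] e

∑-mono : {f g : A → ℕ} → (∀ x → f x ≤ g x) → ∀ xs → ∑[ x ∈ xs ] f x ≤ ∑[ x ∈ xs ] g x
∑-mono f≤g []       = z≤n
∑-mono f≤g (x ∷ xs) = +-mono-≤ (f≤g x) (∑-mono f≤g xs)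

∑-const : ∀ c (xs : List A) → ∑[ x ∈ xs ] c ≡ length xs * c
∑-const c []       = refl
∑-const c (x ∷ xs) = cong (c +_) (∑-const c xs)

*-distribˡ-∑ : ∀ c (f : A → ℕ) xs → c * ∑[ x ∈ xs ] f x ≡ ∑[ x ∈ xs ] (c * f x)
*-distribˡ-∑ c f []       = *-zeroʳ c
*-distribˡ-∑ c f (x ∷ xs) = trans (*-distribˡ-+ c (f x) _) (cong (c * f x +_) (*-distribˡ-∑ c f xs))

fallingBy : ℕ → ℕ → ℕ → ℕ
fallingBy D zero    m = 1
fallingBy D (suc t) m = m * fallingBy D t (m ∸ D)

fallingBy-mono : ∀ D t → m ≤ n → fallingBy D t m ≤ fallingBy D t n
fallingBy-mono D zero    m≤n = ≤-refl
fallingBy-mono D (suc t) m≤n = *-mono-≤ m≤n (fallingBy-mono D t (∸-monoˡ-≤ D m≤n))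

-- The hypothesis says E/2 ≤ m − (t − 1)·D, a lower bound on every factor of the product.
^≤2^*fallingBy : ∀ E D t m → E + 2 * (t * D) ≤ 2 * (D + m) → E ^ t ≤ 2 ^ t * fallingBy D t m
^≤2^*fallingBy E D zero    m _ = ≤-refl
^≤2^*fallingBy E D (suc t) m room = begin
  E * E ^ t                                        ≤⟨ *-mono-≤ E≤2m (^≤2^*fallingBy E D t (m ∸ D) room′) ⟩
  (2 * m) * (2 ^ t * fallingBy D t (m ∸ D))        ≡⟨ *-interchange 2 m (2 ^ t) _ ⟩
  (2 * 2 ^ t) * (m * fallingBy D t (m ∸ D))        ∎
  where
  open ≤-Reasoning
  shiftˡ : ∀ E D t → E + 2 * (suc t * D) ≡ 2 * D + (E + 2 * (t * D))
  shiftˡ = solve-∀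
  E+2tD≤2m : E + 2 * (t * D) ≤ 2 * m
  E+2tD≤2m = +-cancelˡ-≤ (2 * D) _ _ (subst₂ _≤_ (shiftˡ E D t) (*-distribˡ-+ 2 D m) room)
  E≤2m : E ≤ 2 * m
  E≤2m = ≤-trans (m≤m+n E _) E+2tD≤2m
  room′ : E + 2 * (t * D) ≤ 2 * (D + (m ∸ D))
  room′ = ≤-trans E+2tD≤2m (*-monoʳ-≤ 2 (m≤n+m∸n m D))

n!≤n^n : ∀ n → n ! ≤ n ^ n
n!≤n^n zero    = ≤-refl
n!≤n^n (suc n) = *-monoʳ-≤ (suc n) (≤-trans (n!≤n^n n) (^-monoˡ-≤ n (n≤1+n n)))

^-distribʳ-* : ∀ m n o → (m * n) ^ o ≡ m ^ o * n ^ o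
^-distribʳ-* m n zero    = refl
^-distribʳ-* m n (suc o) = trans (cong (m * n *_) (^-distribʳ-* m n o)) (*-interchange m n (m ^ o) (n ^ o))

-- Cliques of a symmetric irreflexive relation

module Cliques {ℓ} {A : Set} {R : Rel A ℓ} (R? : Decidable R) where

  compatible : A → List A → List A
  compatible x = filter (R? x)

  conflicts : A → List A → ℕ
  conflicts x xs = length (filter (∁? (R? x)) xs)

  cliques : ℕ → List A → ℕ
  cliques t xs = length (filter (allPairs? R?) (combinations t xs))

  cliques-cons : ∀ t x xs → cliques (suc t) (x ∷ xs) ≡ cliques t (compatible x xs) + cliques (suc t) xs
  cliques-cons t x xs = begin
    length (filter AP? (map (x ∷_) C ++ combinations (suc t) xs))
      ≡⟨ cong length (filter-++ AP? (map (x ∷_) C) (combinations (suc t) xs)) ⟩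
    length (filter AP? (map (x ∷_) C) ++ filter AP? (combinations (suc t) xs))
      ≡⟨ length-++ (filter AP? (map (x ∷_) C)) ⟩
    length (filter AP? (map (x ∷_) C)) + cliques (suc t) xs
      ≡⟨ cong (_+ cliques (suc t) xs) extending ⟩
    cliques t (compatible x xs) + cliques (suc t) xs ∎
    where
    open ≡-Reasoning
    AP? = allPairs? R?
    C = combinations t xs
    extending : length (filter AP? (map (x ∷_) C)) ≡ cliques t (compatible x xs)
    extending = begin
      length (filter AP? (map (x ∷_) C))
        ≡⟨ cong length (filter-map AP? (x ∷_) C) ⟩
      length (map (x ∷_) (filter (AP? ∘ (x ∷_)) C))
        ≡⟨ length-map (x ∷_) (filter (AP? ∘ (x ∷_)) C) ⟩
      length (filter (AP? ∘ (x ∷_)) C)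
        ≡⟨ cong length (filter-≐ (AP? ∘ (x ∷_)) (AP? ∩? All.all? (R? x))
                          ((λ { (rs ∷ ps) → ps , rs }) , (λ { (ps , rs) → rs ∷ ps })) C) ⟩
      length (filter (AP? ∩? All.all? (R? x)) C)
        ≡⟨ cong length (filter-∩ AP? (All.all? (R? x)) C) ⟩
      length (filter AP? (filter (All.all? (R? x)) C))
        ≡⟨ cong (length ∘ filter AP?) (filter-all-combinations (R? x) t xs) ⟩
      cliques t (compatible x xs) ∎

  module _ (R-sym : Symmetric R) (R-irrefl : ∀ {x} → ¬ R x x) where

    ∑-cliques-compatible-cons : ∀ t x xs ys →
      ∑[ y ∈ ys ] cliques (suc t) (compatible y (x ∷ xs)) ≡
      ∑[ y ∈ ys ] cliques (suc t) (compatible y xs) + ∑[ y ∈ compatible x ys ] cliques t (compatible y (compatible x xs))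
    ∑-cliques-compatible-cons t x xs [] = refl
    ∑-cliques-compatible-cons t x xs (y ∷ ys) with R? y x | R? x y
    ... | yes ryx | no ¬rxy = contradiction (R-sym ryx) ¬rxy
    ... | no ¬ryx | yes rxy = contradiction (R-sym rxy) ¬ryx
    ... | no _    | no _    =
      trans (cong (cliques (suc t) (compatible y xs) +_) (∑-cliques-compatible-cons t x xs ys))
            (sym (+-assoc (cliques (suc t) (compatible y xs)) (∑[ z ∈ ys ] cliques (suc t) (compatible z xs))
                          (∑[ z ∈ compatible x ys ] cliques t (compatible z (compatible x xs)))))
    ... | yes _   | yes _   = begin
      cliques (suc t) (x ∷ compatible y xs) + ∑[ z ∈ ys ] cliques (suc t) (compatible z (x ∷ xs))
        ≡⟨ cong₂ _+_ (cliques-cons t x (compatible y xs)) (∑-cliques-compatible-cons t x xs ys) ⟩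
      (cliques t (compatible x (compatible y xs)) + cliques (suc t) (compatible y xs)) + (Σ₁ + Σ₂)
        ≡⟨ cong (λ zs → (cliques t zs + cliques (suc t) (compatible y xs)) + (Σ₁ + Σ₂)) (filter-comm (R? x) (R? y) xs) ⟩
      (cliques t (compatible y (compatible x xs)) + cliques (suc t) (compatible y xs)) + (Σ₁ + Σ₂)
        ≡⟨ cong (_+ (Σ₁ + Σ₂)) (+-comm (cliques t (compatible y (compatible x xs))) _) ⟩
      (cliques (suc t) (compatible y xs) + cliques t (compatible y (compatible x xs))) + (Σ₁ + Σ₂)
        ≡⟨ +-interchange (cliques (suc t) (compatible y xs)) _ Σ₁ Σ₂ ⟩
      (cliques (suc t) (compatible y xs) + Σ₁) + (cliques t (compatible y (compatible x xs)) + Σ₂) ∎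
      where
      open ≡-Reasoning
      Σ₁ = ∑[ z ∈ ys ] cliques (suc t) (compatible z xs)
      Σ₂ = ∑[ z ∈ compatible x ys ] cliques t (compatible z (compatible x xs))

    -- Double counting: a (t+1)-clique is counted once for each of its t+1 members.
    cliques-handshake : ∀ t xs → suc t * cliques (suc t) xs ≡ ∑[ y ∈ xs ] cliques t (compatible y xs)
    cliques-handshake t       []       = *-zeroʳ (suc t)
    cliques-handshake zero    (x ∷ xs) = begin
      1 * cliques 1 (x ∷ xs)   ≡⟨ *-identityˡ _ ⟩
      cliques 1 (x ∷ xs)       ≡⟨ cliques-cons 0 x xs ⟩
      suc (cliques 1 xs)       ≡⟨ cong suc (*-identityˡ _) ⟨
      suc (1 * cliques 1 xs)   ≡⟨ cong suc (cliques-handshake zero xs) ⟩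
      suc (∑[ y ∈ xs ] 1)      ∎
      where open ≡-Reasoning
    cliques-handshake (suc t) (x ∷ xs) = begin
      suc (suc t) * cliques (suc (suc t)) (x ∷ xs)
        ≡⟨ cong (suc (suc t) *_) (cliques-cons (suc t) x xs) ⟩
      suc (suc t) * (cliques (suc t) F + cliques (suc (suc t)) xs)
        ≡⟨ *-distribˡ-+ (suc (suc t)) (cliques (suc t) F) _ ⟩
      (cliques (suc t) F + suc t * cliques (suc t) F) + suc (suc t) * cliques (suc (suc t)) xs
        ≡⟨ cong₂ (λ a b → (cliques (suc t) F + a) + b) (cliques-handshake t F) (cliques-handshake (suc t) xs) ⟩
      (cliques (suc t) F + Σ₂) + Σ₁
        ≡⟨ +-assoc (cliques (suc t) F) Σ₂ Σ₁ ⟩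
      cliques (suc t) F + (Σ₂ + Σ₁)
        ≡⟨ cong (cliques (suc t) F +_) (+-comm Σ₂ Σ₁) ⟩
      cliques (suc t) F + (Σ₁ + Σ₂)
        ≡⟨ cong₂ _+_ (cong (cliques (suc t)) (filter-reject (R? x) R-irrefl)) (∑-cliques-compatible-cons t x xs xs) ⟨
      cliques (suc t) (compatible x (x ∷ xs)) + ∑[ y ∈ xs ] cliques (suc t) (compatible y (x ∷ xs)) ∎
      where
      open ≡-Reasoning
      F  = compatible x xs
      Σ₁ = ∑[ y ∈ xs ] cliques (suc t) (compatible y xs)
      Σ₂ = ∑[ y ∈ F ] cliques t (compatible y F)

    length∸conflicts≤length-compatible : ∀ {D} y xs → conflicts y xs ≤ D → length xs ∸ D ≤ length (compatible y xs)
    length∸conflicts≤length-compatible {D} y xs few = m≤n+o⇒m∸n≤o (length xs) D (begin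
      length xs                                  ≡⟨ length-filter+length-filter-∁ (R? y) xs ⟨
      length (compatible y xs) + conflicts y xs  ≤⟨ +-monoʳ-≤ (length (compatible y xs)) few ⟩
      length (compatible y xs) + D               ≡⟨ +-comm (length (compatible y xs)) D ⟩
      D + length (compatible y xs)               ∎)
      where open ≤-Reasoning

    fallingBy≤!*cliques : ∀ {D} t xs → (∀ y → conflicts y xs ≤ D) → fallingBy D t (length xs) ≤ t ! * cliques t xs
    fallingBy≤!*cliques     zero    xs _   = ≤-refl
    fallingBy≤!*cliques {D} (suc t) xs few = begin
      length xs * fallingBy D t (length xs ∸ D)
        ≡⟨ ∑-const (fallingBy D t (length xs ∸ D)) xs ⟨
      ∑[ y ∈ xs ] fallingBy D t (length xs ∸ D)
        ≤⟨ ∑-mono (λ y → fallingBy-mono D t (length∸conflicts≤length-compatible y xs (few y))) xs ⟩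
      ∑[ y ∈ xs ] fallingBy D t (length (compatible y xs))
        ≤⟨ ∑-mono (λ y → fallingBy≤!*cliques t (compatible y xs) (λ z → ≤-trans (length-filter-filter (∁? (R? z)) (R? y) xs) (few z))) xs ⟩
      ∑[ y ∈ xs ] (t ! * cliques t (compatible y xs))
        ≡⟨ *-distribˡ-∑ (t !) (λ y → cliques t (compatible y xs)) xs ⟨
      t ! * ∑[ y ∈ xs ] cliques t (compatible y xs)
        ≡⟨ cong (t ! *_) (cliques-handshake t xs) ⟨
      t ! * (suc t * cliques (suc t) xs)
        ≡⟨ *-assoc (t !) (suc t) _ ⟨
      (t ! * suc t) * cliques (suc t) xs
        ≡⟨ cong (_* cliques (suc t) xs) (*-comm (t !) (suc t)) ⟩
      suc t ! * cliques (suc t) xs ∎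
      where open ≤-Reasoning

    length^≤cliques*[2t]^t : ∀ {D} t xs → (∀ y → conflicts y xs ≤ D) → 2 * (t * D) ≤ length xs →
      length xs ^ suc t ≤ cliques (suc t) xs * (2 * suc t) ^ suc t
    length^≤cliques*[2t]^t {D} t xs few room = begin
      E ^ T                                 ≤⟨ ^≤2^*fallingBy E D T E room′ ⟩
      2 ^ T * fallingBy D T E               ≤⟨ *-monoʳ-≤ (2 ^ T) (fallingBy≤!*cliques T xs few) ⟩
      2 ^ T * (T ! * cliques T xs)          ≤⟨ *-monoʳ-≤ (2 ^ T) (*-monoˡ-≤ (cliques T xs) (n!≤n^n T)) ⟩
      2 ^ T * (T ^ T * cliques T xs)        ≡⟨ *-assoc (2 ^ T) (T ^ T) _ ⟨
      (2 ^ T * T ^ T) * cliques T xs        ≡⟨ cong (_* cliques T xs) (^-distribʳ-* 2 T T) ⟨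
      (2 * T) ^ T * cliques T xs            ≡⟨ *-comm ((2 * T) ^ T) _ ⟩
      cliques T xs * (2 * T) ^ T            ∎
      where
      open ≤-Reasoning
      E = length xs
      T = suc t
      shiftˡ : ∀ E D t → 2 * D + E + 2 * (t * D) ≡ E + 2 * (suc t * D)
      shiftˡ = solve-∀
      doubleʳ : ∀ E D → 2 * D + E + E ≡ 2 * (D + E)
      doubleʳ = solve-∀
      room′ : E + 2 * (T * D) ≤ 2 * (D + E)
      room′ = subst₂ _≤_ (shiftˡ E D t) (doubleʳ E D) (+-monoʳ-≤ (2 * D + E) room)

-- Matchings in balanced hypergraphs

uniformBound : ∀ {I : Set} (d : I → ℕ) {E} c → (∀ i → d i ≤ E) → (∀ i → d i * c ≤ E) →
  ∃[ Δ ] (∀ i → d i ≤ Δ) × Δ * c ≤ E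
uniformBound d {E} zero      d≤E _     = E , d≤E , ≤-trans (≤-reflexive (*-zeroʳ E)) z≤n
uniformBound d {E} c@(suc _) _   d*c≤E =
  E / c , (λ i → subst (_≤ E / c) (m*n/n≡m (d i) c) (/-monoˡ-≤ c (d*c≤E i))) , m/n*n≤m E c

Disjoint-sym : ∀ {k s} → Symmetric (Disjoint {k} {s})
Disjoint-sym f∩g=∅ i fᵢ≡gᵢ = f∩g=∅ i (sym fᵢ≡gᵢ)

Disjoint-irrefl : ∀ {k s} {f : Edge (suc k) s} → ¬ Disjoint f f
Disjoint-irrefl f∩f=∅ = f∩f=∅ Fin.zero refl

conflicts≤k*Δ : ∀ {k s} (G : Hypergraph k s) {Δ} → (∀ i w → deg G i w ≤ Δ) →
  ∀ y → Cliques.conflicts disjoint? y (edges G) ≤ k * Δ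
conflicts≤k*Δ {k} G {Δ} deg≤Δ y = begin
  length (filter (∁? (disjoint? y)) (edges G))
    ≡⟨ cong length (filter-≐ (∁? (disjoint? y)) (λ f → any? (λ i → f i ≟ y i)) (meet , apart) (edges G)) ⟩
  length (filter (λ f → any? (λ i → f i ≟ y i)) (edges G))
    ≤⟨ length-filter-any≤ (λ i f → f i ≟ y i) (edges G) (λ i → deg≤Δ i (y i)) ⟩
  k * Δ ∎
  where
  open ≤-Reasoning
  meet : ∀ {f} → ¬ Disjoint y f → ∃ λ i → f i ≡ y i
  meet {f} ¬y∩f=∅ with ¬∀⟶∃¬ k _ (λ i → ¬? (y i ≟ f i)) ¬y∩f=∅
  ... | i , ¬yᵢ≢fᵢ = i , sym (decidable-stable (y i ≟ f i) ¬yᵢ≢fᵢ)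
  apart : ∀ {f} → (∃ λ i → f i ≡ y i) → ¬ Disjoint y f
  apart (i , fᵢ≡yᵢ) y∩f=∅ = y∩f=∅ i (sym fᵢ≡yᵢ)

ℕ→ℚ≡mkℚ : ∀ n → ℕ→ℚ n ≡ ℚ.mkℚ (ℤ.+ n) 0 (Coprimality.sym (Coprimality.1-coprimeTo n))
ℕ→ℚ≡mkℚ n = ℚ.normalize-coprime _

ℕ→ℚ-* : ∀ m n → ℕ→ℚ m ℚ.* ℕ→ℚ n ≡ ℕ→ℚ (m * n)
ℕ→ℚ-* m n rewrite ℕ→ℚ≡mkℚ m | ℕ→ℚ≡mkℚ n = cong (ℚ._/ 1) (ℤ.+◃n≡+n (m * n))

ℕ→ℚ-mono-≤ : m ≤ n → ℕ→ℚ m ℚ.≤ ℕ→ℚ n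
ℕ→ℚ-mono-≤ {m} {n} m≤n rewrite ℕ→ℚ≡mkℚ m | ℕ→ℚ≡mkℚ n =
  ℚ.*≤* (ℤ.*-monoʳ-≤-nonNeg (ℤ.+ 1) (ℤ.+≤+ m≤n))

ℕ→ℚ-cancel-≤ : ℕ→ℚ m ℚ.≤ ℕ→ℚ n → m ≤ n
ℕ→ℚ-cancel-≤ {m} {n} le rewrite ℕ→ℚ≡mkℚ m | ℕ→ℚ≡mkℚ n with le
... | ℚ.*≤* le′ rewrite ℤ.*-identityʳ (ℤ.+ m) | ℤ.*-identityʳ (ℤ.+ n) = ℤ.drop‿+≤+ le′

ℕ→ℚ-nonNeg : ∀ n → ℚ.NonNegative (ℕ→ℚ n)
ℕ→ℚ-nonNeg n rewrite ℕ→ℚ≡mkℚ n = _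

-- In the paper's terms: d(w) ≤ μ e(G) / |X_i| ≤ μ e(G) / |X_j| ≤ e(G) / q.
deg*q≤e : ∀ {k s μ} (G : Hypergraph k s) → ℚ.0ℚ ℚ.< μ → Balanced μ G →
  ∀ {q j} → ℕ→ℚ q ℚ.* μ ℚ.≤ ℕ→ℚ (s j) → (∀ i → s j ≤ s i) → ∀ i w → deg G i w * q ≤ e G
deg*q≤e {s = s} {μ} G μ>0 balanced {q} {j} qμ≤sⱼ sⱼ≤s i w =
  ℕ→ℚ-cancel-≤ {d * q} {e G} (ℚ.*-cancelʳ-≤-pos μ {{ℚ.positive μ>0}} (begin
    ℕ→ℚ (d * q) ℚ.* μ          ≡⟨ cong (ℚ._* μ) (ℕ→ℚ-* d q) ⟨
    (ℕ→ℚ d ℚ.* ℕ→ℚ q) ℚ.* μ    ≡⟨ ℚ.*-assoc (ℕ→ℚ d) (ℕ→ℚ q) μ ⟩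
    ℕ→ℚ d ℚ.* (ℕ→ℚ q ℚ.* μ)    ≤⟨ ℚ.*-monoˡ-≤-nonNeg (ℕ→ℚ d) qμ≤sⱼ ⟩
    ℕ→ℚ d ℚ.* ℕ→ℚ (s j)        ≤⟨ ℚ.*-monoˡ-≤-nonNeg (ℕ→ℚ d) (ℕ→ℚ-mono-≤ {s j} {s i} (sⱼ≤s i)) ⟩
    ℕ→ℚ d ℚ.* ℕ→ℚ (s i)        ≤⟨ balanced i w ⟩
    μ ℚ.* ℕ→ℚ (e G)            ≡⟨ ℚ.*-comm μ (ℕ→ℚ (e G)) ⟩
    ℕ→ℚ (e G) ℚ.* μ            ∎))
  where
  open ℚ.≤-Reasoning
  d = deg G i w
  instance _ = ℕ→ℚ-nonNeg d

lemma5p3 : (k : ℕ) (k≥2 : 2 ≤ k) (μ : ℚ) → ℚ.0ℚ ℚ.< μ →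
    (s : Fin k → ℕ) → (∀ (i j : Fin k) → i Fin.≤ j → s i ≤ s j) →
    (G : Hypergraph k s) → Linear G → Balanced μ G →
    (t : ℕ) → 1 ≤ t →
    ℕ→ℚ ((t ∸ 1) * (2 * k)) ℚ.* μ ℚ.≤ ℕ→ℚ (s (fromℕ< {0} (≤-trans (s≤s z≤n) k≥2))) →
    e G ^ t ≤ numMatchings G t * (2 * t) ^ t
lemma5p3 k@(suc (suc _)) (s≤s (s≤s _)) μ μ>0 s sorted G _ balanced (suc u) (s≤s z≤n) room
  with uniformBound (λ (i , w) → deg G i w) (u * (2 * k))
                    (λ (i , w) → length-filter (λ f → f i ≟ w) (edges G))
                    (λ (i , w) → deg*q≤e G μ>0 balanced room (λ i → sorted Fin.zero i z≤n) i w)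
... | Δ , deg≤Δ , Δ*q≤e =
  Cliques.length^≤cliques*[2t]^t disjoint? Disjoint-sym Disjoint-irrefl u (edges G)
    (conflicts≤k*Δ G (λ i w → deg≤Δ (i , w))) (subst (_≤ e G) (regroup Δ u k) Δ*q≤e)
  where
  regroup : ∀ Δ u k → Δ * (u * (2 * k)) ≡ 2 * (u * (k * Δ))
  regroup = solve-∀
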